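{- Let $\mathcal{G}$ be a hereditary class of graphs such that every graph in $\mathcal{G}$ is $2K_2$-free. If every prime graph in $\mathcal{G}$ is recolorable, then every graph in $\mathcal{G}$ is recolorable.
   Context: Graphs are finite and simple. A class is hereditary if closed under induced subgraphs. $2K_2$ is the disjoint union of two edges; a graph is $2K_2$-free if it has no induced $2K_2$. A $k$-coloring of $G$ is a map $V(G)\to\{1,\dots,k\}$ giving adjacent vertices different colors; $\chi(G)$ is the chromatic number. $R_\ell(G)$ is the graph whose vertices are the $\ell$-colorings of $G$, two adjacent if they differ on exactly one vertex. $G$ is recolorable if $R_\ell(G)$ is connected for every $\ell\ge\chi(G)+1$. A module is a non-empty $S\subseteq V(G)$ such that every vertex outside $S$ is adjacent to all or none of $S$; it is non-trivial if it is a proper subset of $V(G)$ with at least two vertices; $G$ is prime if it has no non-trivial module. -}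

module Defs where

open import Data.Nat using (ℕ; suc; _≤_; _<_)
open import Data.Fin using (Fin)
open import Data.Bool using (Bool; true; false)
open import Data.Vec using (Vec; lookup)
open import Data.Product using (Σ; _×_; ∃-syntax)
open import Data.Sum using (_⊎_)
open import Relation.Nullary using (¬_)
open import Relation.Binary.PropositionalEquality using (_≡_; _≢_)
open import Relation.Binary.Construct.Closure.ReflexiveTransitive using (Star)
open import Function.Definitions using (Injective)

record Graph : Set where
  field
    n      : ℕ
    adj    : Fin n → Fin n → Bool
    sym    : ∀ u v → adj u v ≡ adj v u
    irrefl : ∀ v → adj v v ≡ false
open Graph public

induced : (G : Graph) (m : ℕ) (f : Fin m → Fin (n G)) → Graph
induced G m f = record
  { n = m
  ; adj = λ u v → adj G (f u) (f v)
  ; sym = λ u v → sym G (f u) (f v)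
  ; irrefl = λ v → irrefl G (f v)
  }

-- A class of graphs is a predicate; it is hereditary if closed under
-- induced subgraphs (this includes isomorphic copies, via bijections).
Hereditary : (Graph → Set) → Set
Hereditary C = ∀ G m (f : Fin m → Fin (n G)) →
  Injective _≡_ _≡_ f → C G → C (induced G m f)

-- G contains no induced 2K2: no edges ab, cd with a,b both non-adjacent
-- to c,d (distinctness of a,b,c,d is then automatic).
TwoK2Free : Graph → Set
TwoK2Free G = ¬ (∃[ a ] ∃[ b ] ∃[ c ] ∃[ d ]
  (adj G a b ≡ true × adj G c d ≡ true ×
   adj G a c ≡ false × adj G a d ≡ false ×
   adj G b c ≡ false × adj G b d ≡ false))

Proper : (G : Graph) (k : ℕ) → Vec (Fin k) (n G) → Set
Proper G k c = ∀ u v → adj G u v ≡ true → lookup c u ≢ lookup c v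

Colorable : Graph → ℕ → Set
Colorable G k = Σ (Vec (Fin k) (n G)) (Proper G k)

ChromaticNumber : Graph → ℕ → Set
ChromaticNumber G k = Colorable G k × (∀ j → j < k → ¬ Colorable G j)

RStep : (G : Graph) (ℓ : ℕ) → Vec (Fin ℓ) (n G) → Vec (Fin ℓ) (n G) → Set
RStep G ℓ c d = Proper G ℓ c × Proper G ℓ d ×
  (∃[ v ] (lookup c v ≢ lookup d v ×
           (∀ w → w ≢ v → lookup c w ≡ lookup d w)))

RConnected : (G : Graph) (ℓ : ℕ) → Set
RConnected G ℓ = ∀ c d → Proper G ℓ c → Proper G ℓ d → Star (RStep G ℓ) c d

Recolorable : Graph → Set
Recolorable G = ∀ k → ChromaticNumber G k → ∀ ℓ → suc k ≤ ℓ → RConnected G ℓ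

IsModule : (G : Graph) → (Fin (n G) → Bool) → Set
IsModule G S = (∃[ u ] S u ≡ true) ×
  (∀ v → S v ≡ false →
     (∀ u → S u ≡ true → adj G v u ≡ true) ⊎
     (∀ u → S u ≡ true → adj G v u ≡ false))

NonTrivial : (G : Graph) → (Fin (n G) → Bool) → Set
NonTrivial G S = (∃[ u ] ∃[ w ] (u ≢ w × S u ≡ true × S w ≡ true)) ×
                 (∃[ x ] S x ≡ false)

Prime : Graph → Set
Prime G = ∀ S → IsModule G S → ¬ NonTrivial G S

{-# OPTIONS --safe #-}
-- Induction on the number of vertices; a prime graph is recolorable by hypothesis.  Otherwise G
-- has a non-trivial module S.  If S is independent, two of its vertices are non-adjacent twins.
-- If S spans an edge ab and some y outside S misses a, then y misses all of S, and 2K₂-freeness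
-- gives N(y) ⊆ N(a).  In both cases a vertex y is dominated by a non-neighbor a, and G is
-- recolorable as soon as G − y is: along any recoloring sequence of G − y, y can shadow the color
-- of a.  In the remaining case S is complete to its complement, so G is the join of H = G[S] and
-- K = G − S and χ(G) = χ(H) + χ(K).  With at least χ(G) + 1 colors, each side can be recolored
-- inside a palette that the other side avoids, which turns every coloring into a relabeling of one
-- fixed optimal coloring of G; any two relabelings are connected by moving one color class at a
-- time, using a spare color.
module Submission where

open import Defs renaming (sym to adj-sym)

open import Data.Bool as Bool using (Bool; true; false)
open import Data.Bool.Properties using (¬-not)
open import Data.Empty using (⊥-elim)
open import Data.Fin as Fin using (Fin; zero; suc; toℕ; splitAt; _↑ˡ_; _↑ʳ_)
import Data.Fin.Properties as Fin
open import Data.Fin.Subset using (Subset; inside; outside; _∈_; _∉_; ∣_∣; ∁; ⁅_⁆)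
open import Data.Fin.Subset.Properties
  using (_∈?_; anySubset?; x∈⁅x⁆; x≢y⇒x∉⁅y⁆; x∉p⇒x∈∁p; x∈∁p⇒x∉p; x∉∁p⇒x∈p; x∈p⇒x∉∁p;
         ∈⊤; ⊆⊤; p⊂q⇒∣p∣<∣q∣; ∣⊤∣≡n; ∣∁p∣≡n∸∣p∣; ∣p∣≤n)
open import Data.Nat as ℕ using (ℕ; zero; suc; _+_; _∸_; _≤_; _<_; z≤n; s≤s)
open import Data.Nat.Induction using (<-rec; <-wellFounded)
import Data.Nat.Properties as ℕ
open import Data.Product using (_×_; _,_; proj₁; proj₂; ∃; ∃₂)
open import Data.Sum as Sum using (_⊎_; inj₁; inj₂; [_,_]′)
open import Data.Vec using (Vec; []; _∷_; here; there; lookup; tabulate)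
open import Data.Vec.Properties
  using (lookup∘tabulate; tabulate∘lookup; tabulate-cong; lookup⇒[]=; []=⇒lookup)
open import Data.Vec.Functional using (updateAt; _++_)
open import Data.Vec.Functional.Properties using (updateAt-updates; updateAt-minimal; lookup-++ˡ; lookup-++ʳ)
open import Function using (id; const; _∘_; case_of_)
open import Function.Definitions using (Injective)
open import Induction.WellFounded using (Acc; acc)
open import Relation.Binary.Construct.Closure.ReflexiveTransitive as Star using (Star; ε; _◅_; _◅◅_)
open import Relation.Binary.PropositionalEquality
open import Relation.Nullary using (¬_; Dec; yes; no; does; contradiction)
open import Relation.Nullary.Decidable as Dec using (dec-true; _→-dec_; _×-dec_; _⊎-dec_; ¬?)

-- Subsets and induced subgraphs

embed : ∀ {m} (p : Subset m) → Fin ∣ p ∣ → Fin m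
embed (inside  ∷ p) zero    = zero
embed (inside  ∷ p) (suc i) = suc (embed p i)
embed (outside ∷ p) i       = suc (embed p i)

index : ∀ {m} (p : Subset m) {v} → v ∈ p → Fin ∣ p ∣
index (inside  ∷ p) here        = zero
index (inside  ∷ p) (there v∈p) = suc (index p v∈p)
index (outside ∷ p) (there v∈p) = index p v∈p

embed-∈ : ∀ {m} (p : Subset m) i → embed p i ∈ p
embed-∈ (inside  ∷ p) zero    = here
embed-∈ (inside  ∷ p) (suc i) = there (embed-∈ p i)
embed-∈ (outside ∷ p) i       = there (embed-∈ p i)

embed-index : ∀ {m} (p : Subset m) {v} (v∈p : v ∈ p) → embed p (index p v∈p) ≡ v
embed-index (inside  ∷ p) here        = refl
embed-index (inside  ∷ p) (there v∈p) = cong suc (embed-index p v∈p)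
embed-index (outside ∷ p) (there v∈p) = cong suc (embed-index p v∈p)

embed-injective : ∀ {m} (p : Subset m) {i j} → embed p i ≡ embed p j → i ≡ j
embed-injective (inside  ∷ p) {zero}  {zero}  _  = refl
embed-injective (inside  ∷ p) {suc i} {suc j} eq = cong suc (embed-injective p (Fin.suc-injective eq))
embed-injective (outside ∷ p) {i}     {j}     eq = embed-injective p (Fin.suc-injective eq)

index-irrelevant : ∀ {m} (p : Subset m) {v} (q r : v ∈ p) → index p q ≡ index p r
index-irrelevant p q r = embed-injective p (trans (embed-index p q) (sym (embed-index p r)))

∣p∣<n : ∀ {m} (p : Subset m) {v} → v ∉ p → ∣ p ∣ < m
∣p∣<n {m} p v∉p = subst (∣ p ∣ <_) (∣⊤∣≡n m) (p⊂q⇒∣p∣<∣q∣ (⊆⊤ , _ , ∈⊤ , v∉p))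

∣p∣+∣∁p∣≡n : ∀ {m} (p : Subset m) → ∣ p ∣ + ∣ ∁ p ∣ ≡ m
∣p∣+∣∁p∣≡n p = trans (cong (∣ p ∣ +_) (∣∁p∣≡n∸∣p∣ p)) (ℕ.m+[n∸m]≡n (∣p∣≤n p))

adjacent⇒≢ : ∀ (G : Graph) {u v} → adj G u v ≡ true → u ≢ v
adjacent⇒≢ G {u} uv refl = contradiction (trans (sym uv) (irrefl G u)) λ ()

adj-≡ : ∀ {G : Graph} {u u′ v v′} → u ≡ u′ → v ≡ v′ → adj G u′ v′ ≡ true → adj G u v ≡ true
adj-≡ refl refl uv = uv

_⟨_⟩ : (G : Graph) → Subset (n G) → Graph
G ⟨ p ⟩ = induced G ∣ p ∣ (embed p)

adj-index : ∀ {G} (p : Subset (n G)) {u v} (u∈p : u ∈ p) (v∈p : v ∈ p) →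
            adj G u v ≡ true → adj (G ⟨ p ⟩) (index p u∈p) (index p v∈p) ≡ true
adj-index {G} p u∈p v∈p = adj-≡ {G} (embed-index p u∈p) (embed-index p v∈p)

-- Colorings and the reconfiguration graph

Coloring : Graph → ℕ → Set
Coloring G ℓ = Fin (n G) → Fin ℓ

record IsProper (G : Graph) (ℓ : ℕ) (γ : Coloring G ℓ) : Set where
  constructor proper
  field distinct : ∀ {u v} → adj G u v ≡ true → γ u ≢ γ v
open IsProper public

-- Colorings are handled as functions; R_ℓ(G) itself lives on their tabulations.
Reaches : (G : Graph) (ℓ : ℕ) → Coloring G ℓ → Coloring G ℓ → Set
Reaches G ℓ γ δ = Star (RStep G ℓ) (tabulate γ) (tabulate δ)

restrict-proper : ∀ {G ℓ γ} (p : Subset (n G)) → IsProper G ℓ γ → IsProper (G ⟨ p ⟩) ℓ (γ ∘ embed p)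
restrict-proper p γ-proper = proper (distinct γ-proper)

∘-proper : ∀ {G N ℓ φ} {w : Fin N → Fin ℓ} → Injective _≡_ _≡_ w → IsProper G N φ → IsProper G ℓ (w ∘ φ)
∘-proper w-inj φ-proper = proper λ uv → distinct φ-proper uv ∘ w-inj

tabulated : ∀ {A : Set} {m} (f g : Fin m → A) {u v} →
            f u ≡ g v → lookup (tabulate f) u ≡ lookup (tabulate g) v
tabulated f g {u} {v} eq = trans (lookup∘tabulate f u) (trans eq (sym (lookup∘tabulate g v)))

tabulated⁻ : ∀ {A : Set} {m} (f g : Fin m → A) {u v} →
             lookup (tabulate f) u ≡ lookup (tabulate g) v → f u ≡ g v
tabulated⁻ f g {u} {v} eq = trans (sym (lookup∘tabulate f u)) (trans eq (lookup∘tabulate g v))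

module _ {G : Graph} {ℓ : ℕ} where

  lookup-proper : ∀ c → Proper G ℓ c → IsProper G ℓ (lookup c)
  lookup-proper c c-proper = proper (c-proper _ _)

  proper-tabulate : ∀ {γ} → IsProper G ℓ γ → Proper G ℓ (tabulate γ)
  proper-tabulate {γ} γ-proper u v uv eq = distinct γ-proper uv (tabulated⁻ γ γ eq)

  reaches-≗ : ∀ {γ δ} → γ ≗ δ → Reaches G ℓ γ δ
  reaches-≗ γ≗δ = subst (Star (RStep G ℓ) _) (tabulate-cong γ≗δ) ε

  reaches-reverse : ∀ {γ δ} → Reaches G ℓ γ δ → Reaches G ℓ δ γ
  reaches-reverse = Star.reverse λ (c-proper , d-proper , v , cv≢dv , agree) →
    d-proper , c-proper , v , cv≢dv ∘ sym , λ w w≢v → sym (agree w w≢v)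

  reaches-recolor : ∀ {γ δ} → IsProper G ℓ γ → IsProper G ℓ δ →
                    ∀ v → (∀ w → w ≢ v → γ w ≡ δ w) → Reaches G ℓ γ δ
  reaches-recolor {γ} {δ} γ-proper δ-proper v agree with γ v Fin.≟ δ v
  ... | no γv≢δv = (proper-tabulate γ-proper , proper-tabulate δ-proper , v ,
                    γv≢δv ∘ tabulated⁻ γ δ , λ w w≢v → tabulated γ δ (agree w w≢v)) ◅ ε
  ... | yes γv≡δv = reaches-≗ λ w → case w Fin.≟ v of λ where
    (yes refl) → γv≡δv
    (no w≢v)   → agree w w≢v

  connected : (∀ γ δ → IsProper G ℓ γ → IsProper G ℓ δ → Reaches G ℓ γ δ) → RConnected G ℓ
  connected reach c d c-proper d-proper =
    subst₂ (Star (RStep G ℓ)) (tabulate∘lookup c) (tabulate∘lookup d)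
      (reach (lookup c) (lookup d) (lookup-proper c c-proper) (lookup-proper d d-proper))

  connected⇒reaches : RConnected G ℓ → ∀ {γ δ} → IsProper G ℓ γ → IsProper G ℓ δ → Reaches G ℓ γ δ
  connected⇒reaches conn γ-proper δ-proper =
    conn _ _ (proper-tabulate γ-proper) (proper-tabulate δ-proper)

reaches-map : ∀ {H G p ℓ} (Λ : Coloring H p → Coloring G ℓ) →
              (∀ {σ τ} → σ ≗ τ → Λ σ ≗ Λ τ) →
              (∀ {σ τ} i → IsProper H p σ → IsProper H p τ → (∀ j → j ≢ i → σ j ≡ τ j) →
                 Reaches G ℓ (Λ σ) (Λ τ)) →
              ∀ {σ τ} → Reaches H p σ τ → Reaches G ℓ (Λ σ) (Λ τ)
reaches-map {H} {G} {p} {ℓ} Λ Λ-cong Λ-step {σ} {τ} path =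
  reaches-≗ {G} (Λ-cong {σ} {lookup (tabulate σ)} (sym ∘ lookup∘tabulate σ)) ◅◅
  Star.kleisliStar (λ c → tabulate (Λ (lookup c))) (λ {c} {d} → step {c} {d}) path ◅◅
  reaches-≗ {G} (Λ-cong {lookup (tabulate τ)} {τ} (lookup∘tabulate τ))
  where
    step : ∀ {c d} → RStep H p c d → Reaches G ℓ (Λ (lookup c)) (Λ (lookup d))
    step {c} {d} (c-proper , d-proper , i , _ , agree) =
      Λ-step i (lookup-proper c c-proper) (lookup-proper d d-proper) agree

-- Gluing colorings of G[p] and G − p

module _ {m : ℕ} {A : Set} (p : Subset m) where

  glue : (Fin ∣ p ∣ → A) → (Fin ∣ ∁ p ∣ → A) → Fin m → A
  glue t e v with v ∈? p
  ... | yes v∈p = t (index p v∈p)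
  ... | no  v∉p = e (index (∁ p) (x∉p⇒x∈∁p v∉p))

  glue-∈ : ∀ t e {v} (v∈p : v ∈ p) → glue t e v ≡ t (index p v∈p)
  glue-∈ t e {v} v∈p with v ∈? p
  ... | yes v∈p′ = cong t (index-irrelevant p v∈p′ v∈p)
  ... | no  v∉p  = ⊥-elim (v∉p v∈p)

  glue-∉ : ∀ t e {v} (v∈∁p : v ∈ ∁ p) → glue t e v ≡ e (index (∁ p) v∈∁p)
  glue-∉ t e {v} v∈∁p with v ∈? p
  ... | yes v∈p = ⊥-elim (x∈∁p⇒x∉p v∈∁p v∈p)
  ... | no  v∉p = cong e (index-irrelevant (∁ p) (x∉p⇒x∈∁p v∉p) v∈∁p)

  glue-cong : ∀ {t t′ e e′} → t ≗ t′ → e ≗ e′ → glue t e ≗ glue t′ e′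
  glue-cong t≗t′ e≗e′ v with v ∈? p
  ... | yes v∈p = t≗t′ (index p v∈p)
  ... | no  v∉p = e≗e′ (index (∁ p) (x∉p⇒x∈∁p v∉p))

  glue-restrictions : (γ : Fin m → A) → γ ≗ glue (γ ∘ embed p) (γ ∘ embed (∁ p))
  glue-restrictions γ v with v ∈? p
  ... | yes v∈p = cong γ (sym (embed-index p v∈p))
  ... | no  v∉p = cong γ (sym (embed-index (∁ p) (x∉p⇒x∈∁p v∉p)))

  glue-agree : ∀ {t t′} e i → (∀ j → j ≢ i → t j ≡ t′ j) →
               ∀ v → v ≢ embed p i → glue t e v ≡ glue t′ e v
  glue-agree e i agree v v≢i with v ∈? p
  ... | yes v∈p = agree _ λ eq → v≢i (trans (sym (embed-index p v∈p)) (cong (embed p) eq))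
  ... | no  _   = refl

Confined : ∀ {m ℓ} → Subset m → Subset ℓ → (Fin m → Fin ℓ) → Set
Confined X P γ = (∀ {v} → v ∈ X → γ v ∈ P) × (∀ {v} → v ∉ X → γ v ∉ P)

module _ {m ℓ : ℕ} (p : Subset m) {P : Subset ℓ} {t : Fin ∣ p ∣ → Fin ℓ} {e : Fin ∣ ∁ p ∣ → Fin ℓ} where

  glue-confined : (∀ i → t i ∈ P) → (∀ j → e j ∉ P) → Confined p P (glue p t e)
  glue-confined t∈P e∉P =
    (λ v∈p → subst (_∈ P) (sym (glue-∈ p t e v∈p)) (t∈P _)) ,
    (λ v∉p → subst (_∉ P) (sym (glue-∉ p t e (x∉p⇒x∈∁p v∉p))) (e∉P _))

  glue-confined-∁ : (∀ j → e j ∈ P) → (∀ i → t i ∉ P) → Confined (∁ p) P (glue p t e)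
  glue-confined-∁ e∈P t∉P =
    (λ v∈∁p → subst (_∈ P) (sym (glue-∉ p t e v∈∁p)) (e∈P _)) ,
    (λ v∉∁p → subst (_∉ P) (sym (glue-∈ p t e (x∉∁p⇒x∈p v∉∁p))) (t∉P _))

palette-disjoint : ∀ {m m′ ℓ} {P : Subset ℓ} {t : Fin m → Fin ℓ} {e : Fin m′ → Fin ℓ} →
            (∀ i → t i ∈ P) → (∀ j → e j ∉ P) → ∀ i j → t i ≢ e j
palette-disjoint {P = P} t∈P e∉P i j ti≡ej = e∉P j (subst (_∈ P) ti≡ej (t∈P i))

glue-∘ : ∀ {m} {A B : Set} (p : Subset m) (f : A → B) t e → f ∘ glue p t e ≗ glue p (f ∘ t) (f ∘ e)
glue-∘ p f t e v with v ∈? p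
... | yes _ = refl
... | no  _ = refl

glue-proper : ∀ {G ℓ} (p : Subset (n G)) {t e} → IsProper (G ⟨ p ⟩) ℓ t → IsProper (G ⟨ ∁ p ⟩) ℓ e →
              (∀ i j → t i ≢ e j) → IsProper G ℓ (glue p t e)
glue-proper {G} {ℓ} p {t} {e} t-proper e-proper disjoint = proper separated
  where
  separated : ∀ {u v} → adj G u v ≡ true → glue p t e u ≢ glue p t e v
  separated {u} {v} uv with u ∈? p | v ∈? p
  ... | yes u∈p | yes v∈p = distinct t-proper (adj-index {G} p u∈p v∈p uv)
  ... | yes u∈p | no  v∉p = disjoint _ _
  ... | no  u∉p | yes v∈p = disjoint _ _ ∘ sym
  ... | no  u∉p | no  v∉p = distinct e-proper (adj-index {G} (∁ p) (x∉p⇒x∈∁p u∉p) (x∉p⇒x∈∁p v∉p) uv)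

-- Palettes

∈-tabulate : ∀ {m} {S : Fin m → Bool} {u} → S u ≡ true → u ∈ tabulate S
∈-tabulate {S = S} {u} Su = lookup⇒[]= u (tabulate S) (trans (lookup∘tabulate S u) Su)

∈-tabulate⁻ : ∀ {m} {S : Fin m → Bool} {u} → u ∈ tabulate S → S u ≡ true
∈-tabulate⁻ {S = S} {u} u∈S = trans (sym (lookup∘tabulate S u)) ([]=⇒lookup u∈S)

∉-tabulate : ∀ {m} {S : Fin m → Bool} {u} → S u ≡ false → u ∉ tabulate S
∉-tabulate Su u∈S = contradiction (trans (sym Su) (∈-tabulate⁻ u∈S)) λ ()

∉-tabulate⁻ : ∀ {m} {S : Fin m → Bool} {u} → u ∉ tabulate S → S u ≡ false
∉-tabulate⁻ u∉S = ¬-not (u∉S ∘ ∈-tabulate)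

image : ∀ {h ℓ} → (Fin h → Fin ℓ) → Subset ℓ
image a = tabulate λ c → does (Fin.any? λ i → a i Fin.≟ c)

image-∈ : ∀ {h ℓ} (a : Fin h → Fin ℓ) i → a i ∈ image a
image-∈ a i = ∈-tabulate {S = λ c → does (Fin.any? λ j → a j Fin.≟ c)}
  (dec-true (Fin.any? λ j → a j Fin.≟ a i) (i , refl))

image⁻ : ∀ {h ℓ} (a : Fin h → Fin ℓ) {c} → c ∈ image a → ∃ λ i → a i ≡ c
image⁻ a {c} c∈image with Fin.any? (λ i → a i Fin.≟ c) | ∈-tabulate⁻ c∈image
... | yes found | _  = found
... | no  _     | ()

∣image∣≤ : ∀ {h ℓ} (a : Fin h → Fin ℓ) → ∣ image a ∣ ≤ h
∣image∣≤ a = Fin.injective⇒≤ {f = preimage} λ eq →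
  embed-injective (image a) (trans (sym (preimage-correct _)) (trans (cong a eq) (preimage-correct _)))
  where
    preimage : Fin ∣ image a ∣ → Fin _
    preimage k = proj₁ (image⁻ a (embed-∈ (image a) k))
    preimage-correct : ∀ k → a (preimage k) ≡ embed (image a) k
    preimage-correct k = proj₂ (image⁻ a (embed-∈ (image a) k))

module _ {ℓ : ℕ} (P : Subset ℓ) {h : ℕ} (h≤∣P∣ : h ≤ ∣ P ∣) where

  pick : Fin h → Fin ℓ
  pick i = embed P (Fin.inject≤ i h≤∣P∣)

  pick-∈ : ∀ i → pick i ∈ P
  pick-∈ i = embed-∈ P _

  pick-injective : Injective _≡_ _≡_ pick
  pick-injective = Fin.inject≤-injective _ _ _ _ ∘ embed-injective P

fresh : ∀ {N ℓ} → N < ℓ → (w : Fin N → Fin ℓ) → ∃ λ c → ∀ i → w i ≢ c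
fresh {N} {ℓ} N<ℓ w = pick (∁ (image w)) room zero , λ i wi≡c →
  x∈∁p⇒x∉p (subst (_∈ ∁ (image w)) (sym wi≡c) (pick-∈ (∁ (image w)) room zero)) (image-∈ w i)
  where
    room : 1 ≤ ∣ ∁ (image w) ∣
    room = subst (1 ≤_) (sym (∣∁p∣≡n∸∣p∣ (image w))) (ℕ.m<n⇒0<n∸m (ℕ.≤-<-trans (∣image∣≤ w) N<ℓ))

module _ {m ℓ : ℕ} (P : Subset ℓ) (γ : Fin m → Fin ℓ) (γ∈P : ∀ v → γ v ∈ P) where

  compress : Fin m → Fin ∣ P ∣
  compress v = index P (γ∈P v)

  embed-compress : embed P ∘ compress ≗ γ
  embed-compress v = embed-index P (γ∈P v)

module _ {L : Graph} {ℓ : ℕ} (P : Subset ℓ) {γ : Coloring L ℓ} (γ∈P : ∀ v → γ v ∈ P) where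

  compress-proper : IsProper L ℓ γ → IsProper L ∣ P ∣ (compress P γ γ∈P)
  compress-proper γ-proper = proper λ {u} {v} uv eq → distinct γ-proper uv (begin
    γ u                            ≡⟨ embed-compress P γ γ∈P u ⟨
    embed P (compress P γ γ∈P u)   ≡⟨ cong (embed P) eq ⟩
    embed P (compress P γ γ∈P v)   ≡⟨ embed-compress P γ γ∈P v ⟩
    γ v                            ∎)
    where open ≡-Reasoning

  χ≤∣palette∣ : ∀ {k} → ChromaticNumber L k → IsProper L ℓ γ → k ≤ ∣ P ∣
  χ≤∣palette∣ (_ , minimal) γ-proper = ℕ.≮⇒≥ λ ∣P∣<k →
    minimal _ ∣P∣<k (tabulate (compress P γ γ∈P) , proper-tabulate {L} (compress-proper γ-proper))

any-vector? : ∀ {k} m {P : Vec (Fin k) m → Set} → (∀ c → Dec (P c)) → Dec (∃ P)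
any-vector? zero    P? = Dec.map′ ([] ,_) (λ { ([] , p) → p }) (P? [])
any-vector? (suc m) P? = Dec.map′ (λ (x , xs , p) → x ∷ xs , p) (λ { (x ∷ xs , p) → x , xs , p })
  (Fin.any? λ x → any-vector? m (P? ∘ (x ∷_)))

colorable? : ∀ G k → Dec (Colorable G k)
colorable? G k = any-vector? (n G) λ c →
  Fin.all? λ u → Fin.all? λ v → (adj G u v Bool.≟ true) →-dec ¬? (lookup c u Fin.≟ lookup c v)

least : ∀ {P : ℕ → Set} → (∀ k → Dec (P k)) → ∀ N → P N → ∃ λ k → P k × (∀ j → j < k → ¬ P j)
least {P} P? = <-rec (λ N → P N → ∃ λ k → P k × (∀ j → j < k → ¬ P j)) λ N smaller PN →
  case ℕ.anyUpTo? P? N of λ where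
    (yes (j , j<N , Pj)) → smaller j<N Pj
    (no  none)           → N , PN , λ j j<N Pj → none (j , j<N , Pj)

chromatic-number : ∀ G → ∃ (ChromaticNumber G)
chromatic-number G = least (colorable? G) (n G) (tabulate id , proper-tabulate {G} identity-proper)
  where
    identity-proper : IsProper G (n G) id
    identity-proper = proper (adjacent⇒≢ G)

module _ {G : Graph} {ℓ : ℕ} (X : Subset (n G)) (P : Subset ℓ) where

  -- No vertex outside X uses a color of P, so a recoloring sequence of G ⟨ X ⟩ with the colors of P
  -- lifts to G with the rest of the coloring frozen.
  recolor-within-palette : ∀ {c} → Recolorable (G ⟨ X ⟩) → ChromaticNumber (G ⟨ X ⟩) c → suc c ≤ ∣ P ∣ →
                           ∀ {γ γ′} → IsProper G ℓ γ → IsProper G ℓ γ′ →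
                           Confined X P γ → (∀ {v} → v ∈ X → γ′ v ∈ P) → (∀ v → v ∉ X → γ v ≡ γ′ v) →
                           Reaches G ℓ γ γ′
  recolor-within-palette {c} rec χX room {γ} {γ′} γ-proper γ′-proper (γ-in , γ-out) γ′-in agree =
    reaches-≗ {G} (Λ-restricted γ γ-in λ _ → refl) ◅◅
    reaches-map {G ⟨ X ⟩} {G} Λ (λ σ≗τ → glue-cong X (cong (embed P) ∘ σ≗τ) λ _ → refl) Λ-step
      (connected⇒reaches (rec c χX ∣ P ∣ room)
        (restricted-proper γ-proper γ-in) (restricted-proper γ′-proper γ′-in)) ◅◅
    reaches-≗ {G} (sym ∘ Λ-restricted γ′ γ′-in λ j → sym (agree _ (x∈∁p⇒x∉p (embed-∈ (∁ X) j))))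
    where
      frozen : Fin ∣ ∁ X ∣ → Fin ℓ
      frozen = γ ∘ embed (∁ X)

      Λ : Coloring (G ⟨ X ⟩) ∣ P ∣ → Coloring G ℓ
      Λ σ = glue X (embed P ∘ σ) frozen

      Λ-proper : ∀ {σ} → IsProper (G ⟨ X ⟩) ∣ P ∣ σ → IsProper G ℓ (Λ σ)
      Λ-proper σ-proper =
        glue-proper X (∘-proper (embed-injective P) σ-proper) (restrict-proper (∁ X) γ-proper)
        λ i j eq → γ-out (x∈∁p⇒x∉p (embed-∈ (∁ X) j)) (subst (_∈ P) eq (embed-∈ P _))

      Λ-step : ∀ {σ τ} i → IsProper (G ⟨ X ⟩) ∣ P ∣ σ → IsProper (G ⟨ X ⟩) ∣ P ∣ τ →
               (∀ j → j ≢ i → σ j ≡ τ j) → Reaches G ℓ (Λ σ) (Λ τ)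
      Λ-step i σ-proper τ-proper agree-off-i =
        reaches-recolor (Λ-proper σ-proper) (Λ-proper τ-proper) (embed X i)
        (glue-agree X frozen i λ j j≢i → cong (embed P) (agree-off-i j j≢i))

      restricted : (δ : Coloring G ℓ) → (∀ {v} → v ∈ X → δ v ∈ P) → Coloring (G ⟨ X ⟩) ∣ P ∣
      restricted δ δ-in = compress P (δ ∘ embed X) λ i → δ-in (embed-∈ X i)

      restricted-proper : ∀ {δ} → IsProper G ℓ δ → (δ-in : ∀ {v} → v ∈ X → δ v ∈ P) →
                          IsProper (G ⟨ X ⟩) ∣ P ∣ (restricted δ δ-in)
      restricted-proper δ-proper δ-in =
        compress-proper P (λ i → δ-in (embed-∈ X i)) (restrict-proper X δ-proper)

      Λ-restricted : (δ : Coloring G ℓ) (δ-in : ∀ {v} → v ∈ X → δ v ∈ P) →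
                     δ ∘ embed (∁ X) ≗ frozen → δ ≗ Λ (restricted δ δ-in)
      Λ-restricted δ δ-in same-outside v =
        trans (glue-restrictions X δ v) (glue-cong X (sym ∘ embed-compress P _ _) same-outside v)

-- Recoloring one color class at a time

toℕ≡⇒≡fromℕ< : ∀ {m t} (t<m : t < m) {i : Fin m} → toℕ i ≡ t → i ≡ Fin.fromℕ< t<m
toℕ≡⇒≡fromℕ< t<m i≡t = Fin.toℕ-injective (trans i≡t (sym (Fin.toℕ-fromℕ< t<m)))

module _ {G : Graph} {ℓ : ℕ} where

  reaches-by-mixing : ∀ γ δ → (∀ μ → (∀ v → μ v ≡ γ v ⊎ μ v ≡ δ v) → IsProper G ℓ μ) → Reaches G ℓ γ δ
  reaches-by-mixing γ δ mixture-proper =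
    reaches-≗ {G} (sym ∘ prefix-none) ◅◅ prefixes (n G) ℕ.≤-refl ◅◅ reaches-≗ {G} prefix-all
    where
      prefix : ℕ → Coloring G ℓ
      prefix t v with toℕ v ℕ.<? t
      ... | yes _ = δ v
      ... | no  _ = γ v

      prefix-mixture : ∀ t v → prefix t v ≡ γ v ⊎ prefix t v ≡ δ v
      prefix-mixture t v with toℕ v ℕ.<? t
      ... | yes _ = inj₂ refl
      ... | no  _ = inj₁ refl

      prefix-none : prefix 0 ≗ γ
      prefix-none v with toℕ v ℕ.<? 0
      ... | no _ = refl

      prefix-all : prefix (n G) ≗ δ
      prefix-all v with toℕ v ℕ.<? n G
      ... | yes _   = refl
      ... | no  v≮n = contradiction (Fin.toℕ<n v) v≮n

      prefix-step : ∀ {t} (t<n : t < n G) w → w ≢ Fin.fromℕ< t<n → prefix t w ≡ prefix (suc t) w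
      prefix-step {t} t<n w w≢t with toℕ w ℕ.<? t | toℕ w ℕ.<? suc t
      ... | yes _   | yes _     = refl
      ... | no  _   | no  _     = refl
      ... | yes w<t | no  w≮1+t = contradiction (ℕ.m<n⇒m<1+n w<t) w≮1+t
      ... | no  w≮t | yes w<1+t =
        contradiction (toℕ≡⇒≡fromℕ< t<n (ℕ.≤-antisym (ℕ.≤-pred w<1+t) (ℕ.≮⇒≥ w≮t))) w≢t

      prefixes : ∀ t → t ≤ n G → Reaches G ℓ (prefix 0) (prefix t)
      prefixes zero    _   = ε
      prefixes (suc t) t<n = prefixes t (ℕ.<⇒≤ t<n) ◅◅
        reaches-recolor (mixture-proper _ (prefix-mixture t)) (mixture-proper _ (prefix-mixture (suc t)))
          (Fin.fromℕ< t<n) (prefix-step t<n)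

_[_]≔_ : ∀ {N} {A : Set} → (Fin N → A) → Fin N → A → Fin N → A
w [ j ]≔ c = updateAt w j (const c)

module _ {N : ℕ} {A : Set} (w : Fin N → A) (j : Fin N) (c : A) where

  ≔-cases : ∀ i → (i ≡ j × (w [ j ]≔ c) i ≡ c) ⊎ (i ≢ j × (w [ j ]≔ c) i ≡ w i)
  ≔-cases i with i Fin.≟ j
  ... | yes refl = inj₁ (refl , updateAt-updates j w)
  ... | no  i≢j  = inj₂ (i≢j , updateAt-minimal i j w i≢j)

  ≔-injective : Injective _≡_ _≡_ w → (∀ i → w i ≢ c) → Injective _≡_ _≡_ (w [ j ]≔ c)
  ≔-injective w-inj c-fresh {i} {i′} eq with ≔-cases i | ≔-cases i′
  ... | inj₁ (i≡j , _)   | inj₁ (i′≡j , _)   = trans i≡j (sym i′≡j)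
  ... | inj₁ (_ , wi)    | inj₂ (_ , wi′)    = contradiction (trans (sym wi′) (trans (sym eq) wi)) (c-fresh i′)
  ... | inj₂ (_ , wi)    | inj₁ (_ , wi′)    = contradiction (trans (sym wi) (trans eq wi′)) (c-fresh i)
  ... | inj₂ (_ , wi)    | inj₂ (_ , wi′)    = w-inj (trans (sym wi) (trans eq wi′))

module _ {G : Graph} {N ℓ : ℕ} {Φ : Coloring G N} (Φ-proper : IsProper G N Φ) where

  relabel : ∀ {w w′ : Fin N → Fin ℓ} → Injective _≡_ _≡_ w → Injective _≡_ _≡_ w′ →
            (∀ i i′ → w′ i ≡ w i′ → i ≡ i′) → Reaches G ℓ (w ∘ Φ) (w′ ∘ Φ)
  relabel {w} {w′} w-inj w′-inj cross = reaches-by-mixing {G} _ _ λ μ mixture →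
    proper λ {u} {v} uv μu≡μv → distinct Φ-proper uv (same-class (mixture u) (mixture v) μu≡μv)
    where
      same-class : ∀ {x y c d} → c ≡ w x ⊎ c ≡ w′ x → d ≡ w y ⊎ d ≡ w′ y → c ≡ d → x ≡ y
      same-class (inj₁ c≡) (inj₁ d≡) c≡d = w-inj (trans (sym c≡) (trans c≡d d≡))
      same-class (inj₂ c≡) (inj₂ d≡) c≡d = w′-inj (trans (sym c≡) (trans c≡d d≡))
      same-class (inj₂ c≡) (inj₁ d≡) c≡d = cross _ _ (trans (sym c≡) (trans c≡d d≡))
      same-class (inj₁ c≡) (inj₂ d≡) c≡d = sym (cross _ _ (trans (sym d≡) (trans (sym c≡d) c≡)))

  recolor-class : ∀ {w : Fin N → Fin ℓ} → Injective _≡_ _≡_ w → ∀ j {c} → (∀ i → w i ≢ c) →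
                  Reaches G ℓ (w ∘ Φ) ((w [ j ]≔ c) ∘ Φ)
  recolor-class {w} w-inj j {c} c-fresh = relabel w-inj (≔-injective w j c w-inj c-fresh) cross
    where
      cross : ∀ i i′ → (w [ j ]≔ c) i ≡ w i′ → i ≡ i′
      cross i i′ eq with ≔-cases w j c i
      ... | inj₁ (_ , wi) = contradiction (trans (sym eq) wi) (c-fresh i′)
      ... | inj₂ (_ , wi) = w-inj (trans (sym wi) eq)

  -- Classes N − 1, …, 0 get their target colors in turn; whichever class holds the target color
  -- is first moved to a color used by no class, which exists since N < ℓ.
  relabel-injective : N < ℓ → ∀ {w w′ : Fin N → Fin ℓ} → Injective _≡_ _≡_ w → Injective _≡_ _≡_ w′ →
                      Reaches G ℓ (w ∘ Φ) (w′ ∘ Φ)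
  relabel-injective N<ℓ {w} {w′} w-inj w′-inj =
    settle N ℕ.≤-refl w-inj λ i N≤i → contradiction (Fin.toℕ<n i) (ℕ.≤⇒≯ N≤i)
    where
      Settled : ℕ → (Fin N → Fin ℓ) → Set
      Settled t u = ∀ i → t ≤ toℕ i → u i ≡ w′ i

      vacate : ∀ {u} → Injective _≡_ _≡_ u → ∀ c →
               ∃ λ u₁ → Injective _≡_ _≡_ u₁ × (∀ i → u₁ i ≢ c) × (∀ i → u i ≢ c → u₁ i ≡ u i) ×
                        Reaches G ℓ (u ∘ Φ) (u₁ ∘ Φ)
      vacate {u} u-inj c with Fin.any? (λ i → u i Fin.≟ c) | fresh N<ℓ u
      ... | no  unused        | _ = u , u-inj , (λ i ui≡c → unused (i , ui≡c)) , (λ _ _ → refl) , ε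
      ... | yes (i₀ , ui₀≡c) | f , f-fresh =
        u [ i₀ ]≔ f , ≔-injective u i₀ f u-inj f-fresh , c-unused , kept , recolor-class u-inj i₀ f-fresh
        where
          c-unused : ∀ i → (u [ i₀ ]≔ f) i ≢ c
          c-unused i eq with ≔-cases u i₀ f i
          ... | inj₁ (_ , ui) = f-fresh i₀ (trans ui₀≡c (trans (sym eq) ui))
          ... | inj₂ (i≢i₀ , ui) = i≢i₀ (u-inj (trans (trans (sym ui) eq) (sym ui₀≡c)))
          kept : ∀ i → u i ≢ c → (u [ i₀ ]≔ f) i ≡ u i
          kept i ui≢c with ≔-cases u i₀ f i
          ... | inj₁ (refl , _) = contradiction ui₀≡c ui≢c
          ... | inj₂ (_ , ui)   = ui

      settle : ∀ t → t ≤ N → ∀ {u} → Injective _≡_ _≡_ u → Settled t u → Reaches G ℓ (u ∘ Φ) (w′ ∘ Φ)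
      settle zero    _   _     settled = reaches-≗ {G} λ v → settled (Φ v) z≤n
      settle (suc t) t<N {u} u-inj settled with vacate u-inj (w′ (Fin.fromℕ< t<N))
      ... | u₁ , u₁-inj , u₁-fresh , u₁-kept , vacated =
        vacated ◅◅ recolor-class u₁-inj j u₁-fresh ◅◅
        settle t (ℕ.<⇒≤ t<N) (≔-injective u₁ j (w′ j) u₁-inj u₁-fresh) settled′
        where
          j : Fin N
          j = Fin.fromℕ< t<N
          settled′ : Settled t (u₁ [ j ]≔ w′ j)
          settled′ i t≤i with ≔-cases u₁ j (w′ j) i
          ... | inj₁ (refl , u₂j) = u₂j
          ... | inj₂ (i≢j , u₂i) = trans u₂i (trans (u₁-kept i ui≢w′j) (settled i t<i))
            where
              t<i : suc t ≤ toℕ i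
              t<i = ℕ.≤∧≢⇒< t≤i λ t≡i → i≢j (toℕ≡⇒≡fromℕ< t<N (sym t≡i))
              ui≢w′j : u i ≢ w′ j
              ui≢w′j ui≡w′j = i≢j (w′-inj (trans (sym (settled i t<i)) ui≡w′j))

-- Dominated vertices

updateAt-proper : ∀ {G ℓ δ} → IsProper G ℓ δ → ∀ y {κ} → (∀ {v} → adj G y v ≡ true → κ ≢ δ v) →
                  IsProper G ℓ (δ [ y ]≔ κ)
updateAt-proper {G} {ℓ} {δ} δ-proper y {κ} κ-free = proper separated
  where
    separated : ∀ {u v} → adj G u v ≡ true → (δ [ y ]≔ κ) u ≢ (δ [ y ]≔ κ) v
    separated {u} {v} uv with ≔-cases δ y κ u | ≔-cases δ y κ v
    ... | inj₁ (refl , _)  | inj₁ (refl , _)  = contradiction refl (adjacent⇒≢ G uv)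
    ... | inj₁ (refl , δu) | inj₂ (_ , δv)    = subst₂ _≢_ (sym δu) (sym δv) (κ-free uv)
    ... | inj₂ (_ , δu)    | inj₁ (refl , δv) =
      subst₂ _≢_ (sym δu) (sym δv) (κ-free (trans (adj-sym G v u) uv) ∘ sym)
    ... | inj₂ (_ , δu)    | inj₂ (_ , δv)    = subst₂ _≢_ (sym δu) (sym δv) (distinct δ-proper uv)

record Dominates (G : Graph) (a y : Fin (n G)) : Set where
  field
    y≢a          : y ≢ a
    non-adjacent : adj G y a ≡ false
    N[y]⊆N[a]    : ∀ z → adj G y z ≡ true → adj G a z ≡ true

_∖_ : (G : Graph) → Fin (n G) → Graph
G ∖ y = G ⟨ ∁ ⁅ y ⁆ ⟩

module _ {G : Graph} {a y : Fin (n G)} (a-dominates-y : Dominates G a y) where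

  open Dominates a-dominates-y

  private
    others : ∀ {v} → v ≢ y → v ∈ ∁ ⁅ y ⁆
    others v≢y = x∉p⇒x∈∁p (x≢y⇒x∉⁅y⁆ v≢y)

    â : Fin (n (G ∖ y))
    â = index (∁ ⁅ y ⁆) (others (y≢a ∘ sym))

  -- Sends y to a and fixes the other vertices: a homomorphism G → G ∖ y, as N(y) ⊆ N(a).
  retract : Fin (n G) → Fin (n (G ∖ y))
  retract v with v Fin.≟ y
  ... | yes _   = â
  ... | no  v≢y = index (∁ ⁅ y ⁆) (others v≢y)

  retract-cases : ∀ v → v ≡ y × embed (∁ ⁅ y ⁆) (retract v) ≡ a ⊎ v ≢ y × embed (∁ ⁅ y ⁆) (retract v) ≡ v
  retract-cases v with v Fin.≟ y
  ... | yes refl = inj₁ (refl , embed-index (∁ ⁅ y ⁆) (others (y≢a ∘ sym)))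
  ... | no  v≢y  = inj₂ (v≢y , embed-index (∁ ⁅ y ⁆) (others v≢y))

  retract-adj : ∀ {u v} → adj G u v ≡ true → adj (G ∖ y) (retract u) (retract v) ≡ true
  retract-adj {u} {v} uv with retract-cases u | retract-cases v
  ... | inj₁ (refl , ru) | inj₁ (refl , rv) = contradiction refl (adjacent⇒≢ G uv)
  ... | inj₁ (refl , ru) | inj₂ (_ , rv)    = adj-≡ {G} ru rv (N[y]⊆N[a] v uv)
  ... | inj₂ (_ , ru)    | inj₁ (refl , rv) =
    adj-≡ {G} ru rv (trans (adj-sym G u a) (N[y]⊆N[a] u (trans (adj-sym G y u) uv)))
  ... | inj₂ (_ , ru)    | inj₂ (_ , rv)    = adj-≡ {G} ru rv uv

  embed-retract : ∀ {v} → v ≢ y → embed (∁ ⁅ y ⁆) (retract v) ≡ v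
  embed-retract {v} v≢y with retract-cases v
  ... | inj₁ (v≡y , _) = contradiction v≡y v≢y
  ... | inj₂ (_ , rv)  = rv

  retract-y : retract y ≡ â
  retract-y with retract-cases y
  ... | inj₁ (_ , ry)  =
    embed-injective (∁ ⁅ y ⁆) (trans ry (sym (embed-index (∁ ⁅ y ⁆) (others (y≢a ∘ sym)))))
  ... | inj₂ (y≢y , _) = contradiction refl y≢y

  retract≢â : ∀ {w} → w ≢ a → w ≢ y → retract w ≢ â
  retract≢â {w} w≢a w≢y rw≡â =
    w≢a (trans (sym (embed-retract w≢y)) (trans (cong (embed (∁ ⁅ y ⁆)) rw≡â) (embed-index (∁ ⁅ y ⁆) _)))

  neighbor≢a : ∀ {v} → adj G y v ≡ true → v ≢ a
  neighbor≢a yv refl = contradiction (trans (sym yv) non-adjacent) λ ()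

  retract-proper : ∀ {ℓ σ} → IsProper (G ∖ y) ℓ σ → IsProper G ℓ (σ ∘ retract)
  retract-proper σ-proper = proper (distinct σ-proper ∘ retract-adj)

  χ-delete : ∀ {k} → ChromaticNumber G k → ChromaticNumber (G ∖ y) k
  χ-delete ((c , c-proper) , minimal) =
    (tabulate (lookup c ∘ embed (∁ ⁅ y ⁆)) ,
     proper-tabulate (restrict-proper (∁ ⁅ y ⁆) (lookup-proper {G} c c-proper))) ,
    λ j j<k (c′ , c′-proper) → minimal j j<k
      (tabulate (lookup c′ ∘ retract) , proper-tabulate (retract-proper (lookup-proper c′ c′-proper)))

  retract-step : ∀ {ℓ σ τ} i → IsProper (G ∖ y) ℓ σ → IsProper (G ∖ y) ℓ τ → (∀ j → j ≢ i → σ j ≡ τ j) →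
                 Reaches G ℓ (σ ∘ retract) (τ ∘ retract)
  retract-step {ℓ} {σ} {τ} i σ-proper τ-proper agree with i Fin.≟ â
  ... | no i≢â = reaches-recolor (retract-proper σ-proper) (retract-proper τ-proper) (embed (∁ ⁅ y ⁆) i)
                   λ w w≢i → agree (retract w) (retract≢ w≢i)
    where
      retract≢ : ∀ {w} → w ≢ embed (∁ ⁅ y ⁆) i → retract w ≢ i
      retract≢ {w} w≢i rw≡i with retract-cases w
      ... | inj₁ (refl , _) = i≢â (trans (sym rw≡i) retract-y)
      ... | inj₂ (w≢y , _)  = w≢i (trans (sym (embed-retract w≢y)) (cong (embed (∁ ⁅ y ⁆)) rw≡i))
  -- a moves first while y keeps the old color of a, which is absent from N(y) ⊆ N(a); then y follows.
  ... | yes refl = reaches-recolor (retract-proper σ-proper) middle-proper a recolor-a ◅◅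
                   reaches-recolor middle-proper (retract-proper τ-proper) y
                     λ w w≢y → updateAt-minimal w y _ w≢y
    where
      middle : Coloring G ℓ
      middle = (τ ∘ retract) [ y ]≔ σ â

      middle-proper : IsProper G ℓ middle
      middle-proper = updateAt-proper (retract-proper τ-proper) y λ {v} yv σâ≡τrv →
        distinct σ-proper (subst (λ i → adj (G ∖ y) i (retract v) ≡ true) retract-y (retract-adj yv))
          (trans σâ≡τrv (sym (agree (retract v) (retract≢â (neighbor≢a yv) (adjacent⇒≢ G yv ∘ sym)))))

      recolor-a : ∀ w → w ≢ a → σ (retract w) ≡ middle w
      recolor-a w w≢a with ≔-cases (τ ∘ retract) y (σ â) w
      ... | inj₁ (refl , m) = trans (cong σ retract-y) (sym m)
      ... | inj₂ (w≢y , m)  = trans (agree (retract w) (retract≢â w≢a w≢y)) (sym m)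

  dominated-recolorable : Recolorable (G ∖ y) → Recolorable G
  dominated-recolorable recolorable k χG ℓ k<ℓ = connected λ α β α-proper β-proper →
    via-retract α-proper ◅◅
    reaches-map {G ∖ y} {G} (_∘ retract) (_∘ retract) retract-step
      (connected⇒reaches (recolorable k (χ-delete χG) ℓ k<ℓ)
        (restrict-proper (∁ ⁅ y ⁆) α-proper) (restrict-proper (∁ ⁅ y ⁆) β-proper)) ◅◅
    reaches-reverse {G} (via-retract β-proper)
    where
      via-retract : ∀ {α} → IsProper G ℓ α → Reaches G ℓ α (α ∘ embed (∁ ⁅ y ⁆) ∘ retract)
      via-retract {α} α-proper =
        reaches-recolor α-proper (retract-proper (restrict-proper (∁ ⁅ y ⁆) α-proper)) y
        λ w w≢y → cong α (sym (embed-retract w≢y))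

-- Joins

room-after : ∀ {x y c ℓ} → c ≤ x → suc (x + y) ≤ ℓ → suc y ≤ ℓ ∸ c
room-after {x} {y} {c} {ℓ} c≤x x+y<ℓ =
  ℕ.≤-trans (ℕ.m+n≤o⇒m≤o∸n (suc y) (subst (_≤ ℓ) (cong suc (ℕ.+-comm x y)) x+y<ℓ)) (ℕ.∸-monoʳ-≤ ℓ c≤x)

room-in-∁ : ∀ {ℓ x y} (P : Subset ℓ) → ∣ P ∣ ≤ x → suc (x + y) ≤ ℓ → suc y ≤ ∣ ∁ P ∣
room-in-∁ {ℓ} {y = y} P ∣P∣≤x x+y<ℓ = subst (suc y ≤_) (sym (∣∁p∣≡n∸∣p∣ P)) (room-after ∣P∣≤x x+y<ℓ)

room-split : ∀ {h k ℓ} (T : Subset ℓ) → suc (h + k) ≤ ℓ → suc h ≤ ∣ ∁ T ∣ ⊎ suc k ≤ ∣ T ∣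
room-split {h} {k} {ℓ} T h+k<ℓ with suc k ℕ.≤? ∣ T ∣
... | yes k<∣T∣ = inj₂ k<∣T∣
... | no  k≮∣T∣ = inj₁ (room-in-∁ T (ℕ.≮⇒≥ k≮∣T∣) (subst (λ x → suc x ≤ ℓ) (ℕ.+-comm h k) h+k<ℓ))

++-injective : ∀ {h k ℓ} {a : Fin h → Fin ℓ} {b : Fin k → Fin ℓ} → Injective _≡_ _≡_ a → Injective _≡_ _≡_ b →
               (∀ i j → a i ≢ b j) → Injective _≡_ _≡_ (a ++ b)
++-injective {h} {k} {a = a} {b} a-inj b-inj disjoint {x} {y} eq = begin
  x                       ≡⟨ Fin.join-splitAt h k x ⟨
  Fin.join h k (splitAt h x) ≡⟨ cong (Fin.join h k) (sides (splitAt h x) (splitAt h y) eq) ⟩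
  Fin.join h k (splitAt h y) ≡⟨ Fin.join-splitAt h k y ⟩
  y                       ∎
  where
    open ≡-Reasoning
    sides : ∀ s s′ → [ a , b ]′ s ≡ [ a , b ]′ s′ → s ≡ s′
    sides (inj₁ i) (inj₁ i′) eq = cong inj₁ (a-inj eq)
    sides (inj₁ i) (inj₂ j)  eq = contradiction eq (disjoint i j)
    sides (inj₂ j) (inj₁ i)  eq = contradiction (sym eq) (disjoint i j)
    sides (inj₂ j) (inj₂ j′) eq = cong inj₂ (b-inj eq)

Joined : (G : Graph) → Subset (n G) → Set
Joined G S = ∀ {u v} → u ∈ S → v ∉ S → adj G u v ≡ true

module _ {G : Graph} {S : Subset (n G)} (joined : Joined G S) {h k : ℕ}
         (χH : ChromaticNumber (G ⟨ S ⟩) h) (χK : ChromaticNumber (G ⟨ ∁ S ⟩) k)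
         (H-recolorable : Recolorable (G ⟨ S ⟩)) (K-recolorable : Recolorable (G ⟨ ∁ S ⟩)) where

  private
    H K : Graph
    H = G ⟨ S ⟩
    K = G ⟨ ∁ S ⟩

    φH : Coloring H h
    φH = lookup (proj₁ (proj₁ χH))
    φK : Coloring K k
    φK = lookup (proj₁ (proj₁ χK))

    φH-proper : IsProper H h φH
    φH-proper = lookup-proper {H} (proj₁ (proj₁ χH)) (proj₂ (proj₁ χH))
    φK-proper : IsProper K k φK
    φK-proper = lookup-proper {K} (proj₁ (proj₁ χK)) (proj₂ (proj₁ χK))

  module Sides {ℓ : ℕ} {α : Coloring G ℓ} (α-proper : IsProper G ℓ α) where

    T : Subset ℓ
    T = image (α ∘ embed (∁ S))

    K-side∈T : ∀ j → α (embed (∁ S) j) ∈ T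
    K-side∈T = image-∈ (α ∘ embed (∁ S))

    H-side∉T : ∀ i → α (embed S i) ∉ T
    H-side∉T i αi∈T with image⁻ (α ∘ embed (∁ S)) αi∈T
    ... | j , αj≡αi = distinct α-proper (joined (embed-∈ S i) (x∈∁p⇒x∉p (embed-∈ (∁ S) j))) (sym αj≡αi)

  h+k≤χ : ∀ {c} → ChromaticNumber G c → h + k ≤ c
  h+k≤χ {c} ((col , col-proper) , _) = begin
    h + k           ≤⟨ ℕ.+-mono-≤ (χ≤∣palette∣ (∁ T) (x∉p⇒x∈∁p ∘ H-side∉T) χH (restrict-proper S α-proper))
                                  (χ≤∣palette∣ T K-side∈T χK (restrict-proper (∁ S) α-proper)) ⟩
    ∣ ∁ T ∣ + ∣ T ∣ ≡⟨ ℕ.+-comm ∣ ∁ T ∣ ∣ T ∣ ⟩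
    ∣ T ∣ + ∣ ∁ T ∣ ≡⟨ ∣p∣+∣∁p∣≡n T ⟩
    c               ∎
    where
      open ℕ.≤-Reasoning
      α-proper : IsProper G c (lookup col)
      α-proper = lookup-proper {G} col col-proper
      open Sides α-proper

  module _ {ℓ : ℕ} where

    recolor-H : ∀ {P : Subset ℓ} {t t′ e} → suc h ≤ ∣ P ∣ →
                IsProper H ℓ t → IsProper H ℓ t′ → IsProper K ℓ e →
                (∀ i → t i ∈ P) → (∀ i → t′ i ∈ P) → (∀ j → e j ∉ P) →
                Reaches G ℓ (glue S t e) (glue S t′ e)
    recolor-H {P} {t} {t′} {e} room t-proper t′-proper e-proper t∈P t′∈P e∉P =
      recolor-within-palette {G} S P H-recolorable χH room
        (glue-proper {G} S t-proper e-proper (palette-disjoint t∈P e∉P))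
        (glue-proper {G} S t′-proper e-proper (palette-disjoint t′∈P e∉P))
        (glue-confined S t∈P e∉P) (proj₁ (glue-confined S t′∈P e∉P))
        λ v v∉S → let v∈∁S = x∉p⇒x∈∁p v∉S in trans (glue-∉ S t e v∈∁S) (sym (glue-∉ S t′ e v∈∁S))

    recolor-K : ∀ {P : Subset ℓ} {t e e′} → suc k ≤ ∣ P ∣ →
                IsProper H ℓ t → IsProper K ℓ e → IsProper K ℓ e′ →
                (∀ j → e j ∈ P) → (∀ j → e′ j ∈ P) → (∀ i → t i ∉ P) →
                Reaches G ℓ (glue S t e) (glue S t e′)
    recolor-K {P} {t} {e} {e′} room t-proper e-proper e′-proper e∈P e′∈P t∉P =
      recolor-within-palette {G} (∁ S) P K-recolorable χK room
        (glue-proper {G} S t-proper e-proper λ i j → palette-disjoint e∈P t∉P j i ∘ sym)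
        (glue-proper {G} S t-proper e′-proper λ i j → palette-disjoint e′∈P t∉P j i ∘ sym)
        (glue-confined-∁ S e∈P t∉P) (proj₁ (glue-confined-∁ S e′∈P t∉P))
        λ v v∉∁S → let v∈S = x∉∁p⇒x∈p v∉∁S in trans (glue-∈ S t e v∈S) (sym (glue-∈ S t e′ v∈S))

    Normalized : Coloring G ℓ → Set
    Normalized α = ∃₂ λ (a : Fin h → Fin ℓ) (b : Fin k → Fin ℓ) →
      Injective _≡_ _≡_ a × Injective _≡_ _≡_ b × (∀ i j → a i ≢ b j) ×
      Reaches G ℓ α (glue S (a ∘ φH) (b ∘ φK))

    -- T is the set of colors α uses on K.  Either H can be recolored inside ∁ T and then K
    -- avoiding the new colors of H, or K can be recolored inside T and then H avoiding those of K.
    normalize : suc (h + k) ≤ ℓ → ∀ {α} → IsProper G ℓ α → Normalized α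
    normalize room {α} α-proper = [ H-first , K-first ]′ (room-split T room)
      where
        open Sides α-proper

        αH-proper : IsProper H ℓ (α ∘ embed S)
        αH-proper = restrict-proper S α-proper
        αK-proper : IsProper K ℓ (α ∘ embed (∁ S))
        αK-proper = restrict-proper (∁ S) α-proper

        H-first : suc h ≤ ∣ ∁ T ∣ → Normalized α
        H-first H-room = a , b , a-inj , b-inj , a≢b , path
          where
            a : Fin h → Fin ℓ
            a = pick (∁ T) (ℕ.<⇒≤ H-room)
            a-inj : Injective _≡_ _≡_ a
            a-inj = pick-injective (∁ T) (ℕ.<⇒≤ H-room)
            a-∈ : ∀ i → a i ∈ ∁ T
            a-∈ = pick-∈ (∁ T) (ℕ.<⇒≤ H-room)
            K-room : suc k ≤ ∣ ∁ (image a) ∣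
            K-room = room-in-∁ (image a) (∣image∣≤ a) room
            b : Fin k → Fin ℓ
            b = pick (∁ (image a)) (ℕ.<⇒≤ K-room)
            b-inj : Injective _≡_ _≡_ b
            b-inj = pick-injective (∁ (image a)) (ℕ.<⇒≤ K-room)
            b-∈ : ∀ i → b i ∈ ∁ (image a)
            b-∈ = pick-∈ (∁ (image a)) (ℕ.<⇒≤ K-room)
            a≢b : ∀ i j → a i ≢ b j
            a≢b = palette-disjoint (image-∈ a) (x∈∁p⇒x∉p ∘ b-∈)
            K-side∉image-a : ∀ j → α (embed (∁ S) j) ∉ image a
            K-side∉image-a j αj∈image with image⁻ a αj∈image
            ... | i , ai≡αj = x∈∁p⇒x∉p (subst (_∈ ∁ T) ai≡αj (a-∈ i)) (K-side∈T j)
            path : Reaches G ℓ α (glue S (a ∘ φH) (b ∘ φK))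
            path = reaches-≗ {G} (glue-restrictions S α) ◅◅
              recolor-H H-room αH-proper (∘-proper a-inj φH-proper) αK-proper
                (x∉p⇒x∈∁p ∘ H-side∉T) (a-∈ ∘ φH) (x∈p⇒x∉∁p ∘ K-side∈T) ◅◅
              recolor-K K-room (∘-proper a-inj φH-proper) αK-proper (∘-proper b-inj φK-proper)
                (x∉p⇒x∈∁p ∘ K-side∉image-a) (b-∈ ∘ φK) (x∈p⇒x∉∁p ∘ image-∈ a ∘ φH)

        K-first : suc k ≤ ∣ T ∣ → Normalized α
        K-first K-room = a , b , a-inj , b-inj , a≢b , path
          where
            b : Fin k → Fin ℓ
            b = pick T (ℕ.<⇒≤ K-room)
            b-inj : Injective _≡_ _≡_ b
            b-inj = pick-injective T (ℕ.<⇒≤ K-room)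
            b-∈ : ∀ i → b i ∈ T
            b-∈ = pick-∈ T (ℕ.<⇒≤ K-room)
            H-room : suc h ≤ ∣ ∁ (image b) ∣
            H-room = room-in-∁ (image b) (∣image∣≤ b) (subst (λ x → suc x ≤ ℓ) (ℕ.+-comm h k) room)
            a : Fin h → Fin ℓ
            a = pick (∁ (image b)) (ℕ.<⇒≤ H-room)
            a-inj : Injective _≡_ _≡_ a
            a-inj = pick-injective (∁ (image b)) (ℕ.<⇒≤ H-room)
            a-∈ : ∀ i → a i ∈ ∁ (image b)
            a-∈ = pick-∈ (∁ (image b)) (ℕ.<⇒≤ H-room)
            a≢b : ∀ i j → a i ≢ b j
            a≢b i j = palette-disjoint (image-∈ b) (x∈∁p⇒x∉p ∘ a-∈) j i ∘ sym
            H-side∉image-b : ∀ i → α (embed S i) ∉ image b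
            H-side∉image-b i αi∈image with image⁻ b αi∈image
            ... | j , bj≡αi = H-side∉T i (subst (_∈ T) bj≡αi (b-∈ j))
            path : Reaches G ℓ α (glue S (a ∘ φH) (b ∘ φK))
            path = reaches-≗ {G} (glue-restrictions S α) ◅◅
              recolor-K K-room αH-proper αK-proper (∘-proper b-inj φK-proper)
                K-side∈T (b-∈ ∘ φK) H-side∉T ◅◅
              recolor-H H-room αH-proper (∘-proper a-inj φH-proper) (∘-proper b-inj φK-proper)
                (x∉p⇒x∈∁p ∘ H-side∉image-b) (a-∈ ∘ φH) (x∈p⇒x∉∁p ∘ image-∈ b ∘ φK)

  Φ : Coloring G (h + k)
  Φ = glue S (λ i → φH i ↑ˡ k) (λ j → h ↑ʳ φK j)

  Φ-proper : IsProper G (h + k) Φ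
  Φ-proper = glue-proper {G} S (∘-proper (Fin.↑ˡ-injective k _ _) φH-proper)
                               (∘-proper (Fin.↑ʳ-injective h _ _) φK-proper)
    λ i j eq → contradiction
      (trans (sym (Fin.splitAt-↑ˡ h (φH i) k)) (trans (cong (splitAt h) eq) (Fin.splitAt-↑ʳ h k (φK j)))) λ ()

  glue-labelled : ∀ {ℓ} (a : Fin h → Fin ℓ) (b : Fin k → Fin ℓ) → glue S (a ∘ φH) (b ∘ φK) ≗ (a ++ b) ∘ Φ
  glue-labelled a b v = sym (trans (glue-∘ S (a ++ b) _ _ v)
    (glue-cong S (λ i → lookup-++ˡ a b (φH i)) (λ j → lookup-++ʳ a b (φK j)) v))

  join-recolorable : Recolorable G
  join-recolorable c χG ℓ c<ℓ = connected reach
    where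
      room : suc (h + k) ≤ ℓ
      room = ℕ.≤-trans (s≤s (h+k≤χ χG)) c<ℓ

      labelled : ∀ {α} → IsProper G ℓ α → ∃ λ w → Injective _≡_ _≡_ w × Reaches G ℓ α (w ∘ Φ)
      labelled α-proper =
        let a , b , a-inj , b-inj , a≢b , path = normalize room α-proper
        in a ++ b , ++-injective {a = a} {b} a-inj b-inj a≢b ,
           path ◅◅ reaches-≗ {G} {ℓ} {glue S (a ∘ φH) (b ∘ φK)} {(a ++ b) ∘ Φ} (glue-labelled a b)

      reach : ∀ α β → IsProper G ℓ α → IsProper G ℓ β → Reaches G ℓ α β
      reach α β α-proper β-proper =
        let w , w-inj , α⇝w = labelled α-proper
            w′ , w′-inj , β⇝w′ = labelled β-proper
        in α⇝w ◅◅ relabel-injective Φ-proper room {w} {w′} w-inj w′-inj ◅◅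
           reaches-reverse {G} {ℓ} {β} {w′ ∘ Φ} β⇝w′

-- Modules

module _ {G : Graph} where

  module? : ∀ S → Dec (IsModule G S)
  module? S = Fin.any? (λ u → S u Bool.≟ true) ×-dec Fin.all? λ v → (S v Bool.≟ false) →-dec
    (Fin.all? (λ u → (S u Bool.≟ true) →-dec (adj G v u Bool.≟ true)) ⊎-dec
     Fin.all? (λ u → (S u Bool.≟ true) →-dec (adj G v u Bool.≟ false)))

  nonTrivial? : ∀ S → Dec (NonTrivial G S)
  nonTrivial? S =
    Fin.any? (λ u → Fin.any? λ w → ¬? (u Fin.≟ w) ×-dec (S u Bool.≟ true) ×-dec (S w Bool.≟ true)) ×-dec
    Fin.any? (λ x → S x Bool.≟ false)

  module _ {S S′ : Fin (n G) → Bool} (S≗S′ : S ≗ S′) where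

    module-≗ : IsModule G S → IsModule G S′
    module-≗ ((u , Su) , sides) = (u , trans (sym (S≗S′ u)) Su) , λ v S′v →
      Sum.map (λ all w S′w → all w (trans (S≗S′ w) S′w)) (λ all w S′w → all w (trans (S≗S′ w) S′w))
        (sides v (trans (S≗S′ v) S′v))

    nonTrivial-≗ : NonTrivial G S → NonTrivial G S′
    nonTrivial-≗ ((u , w , u≢w , Su , Sw) , (x , Sx)) =
      (u , w , u≢w , trans (sym (S≗S′ u)) Su , trans (sym (S≗S′ w)) Sw) , (x , trans (sym (S≗S′ x)) Sx)

  prime-or-module : Prime G ⊎ ∃ λ S → IsModule G S × NonTrivial G S
  prime-or-module with anySubset? (λ p → module? (lookup p) ×-dec nonTrivial? (lookup p))
  ... | yes (p , found) = inj₂ (lookup p , found)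
  ... | no  none        = inj₁ λ S S-module S-nontrivial →
    let S≗ = sym ∘ lookup∘tabulate S
    in none (tabulate S , module-≗ S≗ S-module , nonTrivial-≗ S≗ S-nontrivial)

module _ {G : Graph} {S : Fin (n G) → Bool} (S-module : IsModule G S) where

  independent-module-dominated : (∀ {a b} → S a ≡ true → S b ≡ true → adj G a b ≡ false) →
                                 ∀ {u w} → u ≢ w → S u ≡ true → S w ≡ true → Dominates G u w
  independent-module-dominated independent {u} {w} u≢w Su Sw = record
    { y≢a = u≢w ∘ sym ; non-adjacent = independent Sw Su ; N[y]⊆N[a] = N[w]⊆N[u] }
    where
      N[w]⊆N[u] : ∀ z → adj G w z ≡ true → adj G u z ≡ true
      N[w]⊆N[u] z wz with S z in Sz
      ... | true  = contradiction (trans (sym wz) (independent Sw Sz)) λ ()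
      ... | false with proj₂ S-module z Sz
      ...   | inj₁ complete     = trans (adj-sym G u z) (complete u Su)
      ...   | inj₂ anticomplete =
        contradiction (trans (sym wz) (trans (adj-sym G w z) (anticomplete w Sw))) λ ()

  anticomplete-dominated : TwoK2Free G → ∀ {a b y} → adj G a b ≡ true → S a ≡ true → S b ≡ true →
                           S y ≡ false → adj G y a ≡ false → Dominates G a y
  anticomplete-dominated 2K2-free {a} {b} {y} ab Sa Sb Sy ya = record
    { y≢a = y≢a ; non-adjacent = ya ; N[y]⊆N[a] = N[y]⊆N[a] }
    where
      y≢a : y ≢ a
      y≢a refl = contradiction (trans (sym Sa) Sy) λ ()

      y-anticomplete : ∀ u → S u ≡ true → adj G y u ≡ false
      y-anticomplete with proj₂ S-module y Sy
      ... | inj₁ complete     = contradiction (trans (sym (complete a Sa)) ya) λ ()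
      ... | inj₂ anticomplete = anticomplete

      N[y]⊆N[a] : ∀ z → adj G y z ≡ true → adj G a z ≡ true
      N[y]⊆N[a] z yz with S z in Sz
      ... | true  = contradiction (trans (sym yz) (y-anticomplete z Sz)) λ ()
      ... | false with proj₂ S-module z Sz
      ...   | inj₁ complete     = trans (adj-sym G a z) (complete a Sa)
      ...   | inj₂ anticomplete = contradiction
        (a , b , y , z , ab , yz , trans (adj-sym G a y) ya , trans (adj-sym G a z) (anticomplete a Sa) ,
         trans (adj-sym G b y) (y-anticomplete b Sb) , trans (adj-sym G b z) (anticomplete b Sb)) 2K2-free

  complete-module-joined : ∀ {a} → S a ≡ true → (∀ {y} → S y ≡ false → adj G y a ≡ true) →
                           Joined G (tabulate S)
  complete-module-joined Sa a-complete {u} {v} u∈S v∉S with proj₂ S-module v (∉-tabulate⁻ v∉S)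
  ... | inj₁ complete     = trans (adj-sym G u v) (complete u (∈-tabulate⁻ u∈S))
  ... | inj₂ anticomplete =
    contradiction (trans (sym (a-complete (∉-tabulate⁻ v∉S))) (anticomplete _ Sa)) λ ()

module-dichotomy : ∀ {G S} → TwoK2Free G → IsModule G S → NonTrivial G S →
                   (∃₂ λ a y → Dominates G a y) ⊎ Joined G (tabulate S)
module-dichotomy {G} {S} 2K2-free S-module ((u , w , u≢w , Su , Sw) , _)
  with Fin.any? (λ a → Fin.any? λ b → (S a Bool.≟ true) ×-dec (S b Bool.≟ true) ×-dec (adj G a b Bool.≟ true))
... | no no-edge = inj₁ (u , w , independent-module-dominated {G} {S} S-module
        (λ {a} {b} Sa Sb → ¬-not λ ab → no-edge (a , b , Sa , Sb , ab)) u≢w Su Sw)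
... | yes (a , b , Sa , Sb , ab) with Fin.any? (λ y → (S y Bool.≟ false) ×-dec (adj G y a Bool.≟ false))
...   | yes (y , Sy , ya) = inj₁ (a , y , anticomplete-dominated {G} {S} S-module 2K2-free ab Sa Sb Sy ya)
...   | no  none         =
  inj₂ (complete-module-joined {G} {S} S-module Sa λ {y} Sy → ¬-not λ ya → none (y , Sy , ya))

recolorable-from-induced : ∀ {G} → TwoK2Free G → (Prime G → Recolorable G) →
                           (∀ {p : Subset (n G)} {v} → v ∉ p → Recolorable (G ⟨ p ⟩)) → Recolorable G
recolorable-from-induced {G} 2K2-free prime-recolorable smaller with prime-or-module {G}
... | inj₁ prime = prime-recolorable prime
... | inj₂ (S , S-module , S-nontrivial@((u , _ , _ , Su , _) , (x , Sx)))
  with module-dichotomy {G} {S} 2K2-free S-module S-nontrivial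
...   | inj₁ (a , y , a-dominates-y) = dominated-recolorable {G} a-dominates-y (smaller (x∈p⇒x∉∁p (x∈⁅x⁆ y)))
...   | inj₂ joined =
  join-recolorable {G} joined (proj₂ (chromatic-number (G ⟨ tabulate S ⟩)))
                              (proj₂ (chromatic-number (G ⟨ ∁ (tabulate S) ⟩)))
                              (smaller (∉-tabulate Sx)) (smaller (x∈p⇒x∉∁p (∈-tabulate Su)))

theorem11 : (C : Graph → Set) → Hereditary C →
    (∀ G → C G → TwoK2Free G) →
    (∀ G → C G → Prime G → Recolorable G) →
    ∀ G → C G → Recolorable G
theorem11 C hereditary 2K2-free prime-recolorable G CG = recolorable G CG (<-wellFounded (n G))
  where
    recolorable : ∀ G → C G → Acc _<_ (n G) → Recolorable G
    recolorable G CG (acc smaller) = recolorable-from-induced {G} (2K2-free G CG) (prime-recolorable G CG)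
      λ {p} v∉p → recolorable (G ⟨ p ⟩) (hereditary G _ (embed p) (embed-injective p) CG)
                                        (smaller (∣p∣<n p v∉p))
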